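{- Let $G=(V,E)$ be a finite simple undirected graph with maximum vertex degree $\Delta(G)$. Then \[\Delta(G) \le \mathrm{RTD}(\mathcal{C}_{star}(G)) \le \Delta(G)+1 .\]
   Context: For a vertex $x$, $N_G^o(x)=\{y : \{x,y\}\in E\}$ is its open neighborhood. The concept class $\mathcal{C}_{star}(G)$ over the domain $V$ is $\{X\cup\{x\} : x\in V,\ X\subseteq N_G^o(x)\}$; concepts are subsets of $V$. For a finite concept class $\mathcal{C}$ over a finite domain $\mathcal{X}$, a teaching set for $C\in\mathcal{C}$ is a set $D\subseteq \mathcal{X}$ such that for every $C'\in\mathcal{C}\setminus\{C\}$ there is $x\in D$ with ($x\in C \iff x\notin C'$). $\mathrm{TD}(C,\mathcal{C})$ is the minimum size of such a set, and $\mathrm{TD}_{min}(\mathcal{C})=\min_{C\in\mathcal{C}}\mathrm{TD}(C,\mathcal{C})$. Let $\mathcal{C}_{min}=\{C\in\mathcal{C}: \mathrm{TD}(C,\mathcal{C})=\mathrm{TD}_{min}(\mathcal{C})\}$. The recursive teaching dimension is defined recursively by $\mathrm{RTD}(\mathcal{C})=\mathrm{TD}_{min}(\mathcal{C})$ if $\mathcal{C}=\mathcal{C}_{min}$, and $\mathrm{RTD}(\mathcal{C})=\max\{\mathrm{TD}_{min}(\mathcal{C}),\mathrm{RTD}(\mathcal{C}\setminus\mathcal{C}_{min})\}$ otherwise. -}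

module Defs where

open import Data.Bool using (Bool; true; false; _∧_; _∨_; _xor_; not; if_then_else_)
open import Data.Nat using (ℕ; zero; suc; _⊔_; _⊓_; _^_; _+_)
open import Data.Fin using (Fin; _≟_)
open import Data.Fin.Subset using (Subset; ∣_∣)
open import Data.Vec using (Vec; []; _∷_; lookup; replicate)
open import Data.List using (List; []; _∷_; map; filter; foldr; allFin; _++_)
open import Data.Bool.ListAction using (all; any)
open import Relation.Nullary.Decidable using (⌊_⌋)
open import Relation.Binary.PropositionalEquality using (_≡_)

record Graph (n : ℕ) : Set where
  field
    adj   : Fin n → Fin n → Bool
    sym   : ∀ x y → adj x y ≡ adj y x
    irrfl : ∀ x → adj x x ≡ false
open Graph public

degree : ∀ {n} → Graph n → Fin n → ℕ
degree {n} G x = Data.List.length (filter (λ y → adj G x y Data.Bool.≟ true) (allFin n))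

-- maximum degree Δ(G) (0 for the empty graph)
Δ : ∀ {n} → Graph n → ℕ
Δ {n} G = foldr _⊔_ 0 (map (degree G) (allFin n))

Concept : ℕ → Set
Concept n = Subset n

Class : ℕ → Set
Class n = Concept n → Bool

allSubsets : ∀ n → List (Subset n)
allSubsets zero = [] ∷ []
allSubsets (suc n) = map (true ∷_) (allSubsets n) ++ map (false ∷_) (allSubsets n)

members : ∀ {n} → Class n → List (Concept n)
members {n} 𝒞 = filter (λ C → 𝒞 C Data.Bool.≟ true) (allSubsets n)

eqC : ∀ {n} → Concept n → Concept n → Bool
eqC {n} C C' = all (λ x → not (lookup C x xor lookup C' x)) (allFin n)

isTeachingSet : ∀ {n} → Class n → Concept n → Subset n → Bool
isTeachingSet {n} 𝒞 C D =
  all (λ C' → eqC C' C ∨ any (λ x → lookup D x ∧ (lookup C x xor lookup C' x)) (allFin n))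
      (members 𝒞)

-- TD(C,𝒞): minimum size of a teaching set (the full domain is always
-- one, so the minimum is over a nonempty list; n is only a seed)
TD : ∀ {n} → Class n → Concept n → ℕ
TD {n} 𝒞 C =
  foldr _⊓_ n (map ∣_∣ (filter (λ D → isTeachingSet 𝒞 C D Data.Bool.≟ true) (allSubsets n)))

-- TD_min(𝒞) = min over C ∈ 𝒞 of TD(C,𝒞)  (convention: 0 for the empty class)
TDmin : ∀ {n} → Class n → ℕ
TDmin {n} 𝒞 with members 𝒞
... | [] = 0
... | C ∷ Cs = foldr _⊓_ (TD 𝒞 C) (map (TD 𝒞) Cs)

Cmin : ∀ {n} → Class n → Class n
Cmin 𝒞 C = 𝒞 C ∧ ⌊ TD 𝒞 C Data.Nat.≟ TDmin 𝒞 ⌋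

Crest : ∀ {n} → Class n → Class n
Crest 𝒞 C = 𝒞 C ∧ not (Cmin 𝒞 C)

allMin : ∀ {n} → Class n → Bool
allMin 𝒞 = all (Cmin 𝒞) (members 𝒞)

-- RTD with fuel; each step removes the nonempty 𝒞_min, so fuel
-- 2^n + 1 (more than the number of concepts) is always sufficient.
RTD-fuel : ∀ {n} → ℕ → Class n → ℕ
RTD-fuel zero 𝒞 = 0
RTD-fuel (suc k) 𝒞 =
  if allMin 𝒞 then TDmin 𝒞 else (TDmin 𝒞 ⊔ RTD-fuel k (Crest 𝒞))

RTD : ∀ {n} → Class n → ℕ
RTD {n} 𝒞 = RTD-fuel (2 ^ n + 1) 𝒞

-- C_star(G) = { X ∪ {x} : x ∈ V, X ⊆ N^o(x) }.
-- C ∈ C_star(G) iff for some x: x ∈ C and every y ∈ C is x or adjacent to x.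

Cstar : ∀ {n} → Graph n → Class n
Cstar {n} G C =
  any (λ x → lookup C x ∧
             all (λ y → not (lookup C y) ∨ ⌊ y ≟ x ⌋ ∨ adj G x y) (allFin n))
      (allFin n)

{-# OPTIONS --safe #-}
module Submission where

-- In any class, a concept C of maximal size is a teaching set for itself: a
-- concept C′ ≠ C that agrees with C on C contains C and is therefore larger. A star X ∪ {x}
-- has at most deg x + 1 ≤ Δ + 1 elements, and every class reached by the recursion is a
-- subclass of C_star, so every stage has TD_min ≤ Δ + 1.
--
-- Let x have maximal degree. The stars centred at x form a cube over N(x):
-- toggling a neighbour y in such a star gives another one that differs from it only at y,
-- so in any class containing all of them every teaching set for one of them contains N(x)
-- and has size at least Δ. They all stay in the class until the recursion removes one of
-- them as part of 𝒞_min, and at that stage TD_min ≥ Δ.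

open import Defs hiding (sym)
open import Data.Nat using (ℕ; zero; suc; _≤_; _<_; _+_; _⊓_; _⊔_; _^_; z≤n; s≤s; s≤s⁻¹; z<s)
open import Data.Product using (_×_; _,_; proj₁; proj₂; ∃-syntax)

open import Data.Bool.Base using (Bool; true; false; T; not; _∧_; _∨_; _xor_)
open import Data.Bool.Properties using (T-≡; T-∧; T-∨; not-¬) renaming (_≟_ to _≟ᵇ_)
open import Data.Bool.ListAction using (all; any)
open import Data.Fin as Fin using (Fin; _≟_)
open import Data.Fin.Subset using (Subset; ∣_∣; _∈_; _⊆_; _∪_; ⁅_⁆; inside; outside)
open import Data.Fin.Subset.Properties
  using (_∈?_; drop-∷-⊆; p⊆q⇒∣p∣≤∣q∣; ∣p∣≤n; ∣⁅x⁆∣≡1; x∈⁅x⁆; x∈⁅y⁆⇔x≡y; x∈p∪q⁺; x∈p∪q⁻)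
open import Data.List.Base as List
  using (List; []; _∷_; map; filter; foldr; _++_; length; allFin)
open import Data.List.Extrema.Nat using (argmax; argmax-sel; f[xs]≤f[argmax])
open import Data.List.Membership.Propositional using (lose) renaming (_∈_ to _∈ₗ_)
open import Data.List.Membership.Propositional.Properties
  using (∈-allFin; ∈-map⁺; ∈-map⁻; ∈-filter⁺; ∈-filter⁻; ∈-++⁺ˡ; ∈-++⁺ʳ; foldr-selective)
open import Data.List.Properties
  using (length-++; length-map; length-filter; foldr-preservesᵇ; foldr-preservesᵒ)
open import Data.List.Relation.Binary.Sublist.Propositional using (⊆-refl)
open import Data.List.Relation.Binary.Sublist.Propositional.Properties
  using (filter⁺; length-mono-≤)
open import Data.List.Relation.Unary.All as All using (All)
open import Data.List.Relation.Unary.All.Properties using (all⁺; all⁻; map⁺)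
open import Data.List.Relation.Unary.Any using (here; there; satisfied; any?)
open import Data.List.Relation.Unary.Any.Properties using (any⁺; any⁻)
open import Data.Nat.Properties
  using (≤-refl; ≤-reflexive; ≤-trans; ≤-<-trans; module ≤-Reasoning; +-comm; +-suc;
         +-identityʳ; +-monoʳ-≤; n≤1+n; 1+n≰n; m≤n⇒m≤1+n; m<m+n; m⊓n≤m; m⊓n≤n; ⊓-glb;
         ⊓-sel; m≤m⊔n; m≤n⊔m; ⊔-lub; ⊔-sel)
open import Data.Sum using (_⊎_; inj₁; inj₂; [_,_]′) renaming (map to ⊎-map)
open import Data.Vec.Base as Vec using ([]; _∷_; lookup; tabulate; _[_]≔_)
open import Data.Vec.Properties
  using (≡-dec; []=⇒lookup; lookup⇒[]=; lookup∘update; lookup∘update′; lookup∘tabulate;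
         tabulate∘lookup; tabulate-cong; []≔-minimal)
open import Function using (_∘_; _⇔_; mk⇔; Equivalence)
open import Level using (Level)
open import Relation.Binary.PropositionalEquality
  using (_≡_; _≢_; refl; sym; trans; cong; cong₂; subst; module ≡-Reasoning)
open import Relation.Nullary using (¬_; yes; no; contradiction)
open import Relation.Nullary.Decidable using (⌊_⌋; toWitness; fromWitness; T?)
open import Relation.Unary using (Pred; Decidable)

open Equivalence using (to; from)

private
  variable
    a : Level
    A : Set a
    n b : ℕ
    x y : Fin n
    C C′ D c : Subset n
    𝒞 𝒟 : Class n

T-not : ∀ {u} → T (not u) ⇔ (¬ T u)
T-not {false} = mk⇔ (λ _ ()) (λ _ → _)
T-not {true}  = mk⇔ (λ ()) (λ ¬t → ¬t _)

T-not-∨ : ∀ {u v} → T (not u ∨ v) ⇔ (T u → T v)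
T-not-∨ {false} = mk⇔ (λ _ ()) (λ _ → _)
T-not-∨ {true}  = mk⇔ (λ t _ → t) (λ f → f _)

T-xor : ∀ {u v} → T (u xor v) ⇔ (u ≢ v)
T-xor {false} {false} = mk⇔ (λ ()) (λ u≢v → u≢v refl)
T-xor {false} {true}  = mk⇔ (λ _ ()) (λ _ → _)
T-xor {true}  {false} = mk⇔ (λ _ ()) (λ _ → _)
T-xor {true}  {true}  = mk⇔ (λ ()) (λ u≢v → u≢v refl)

T-not-xor : ∀ {u v} → T (not (u xor v)) ⇔ (u ≡ v)
T-not-xor {false} {false} = mk⇔ (λ _ → refl) (λ _ → _)
T-not-xor {false} {true}  = mk⇔ (λ ()) (λ ())
T-not-xor {true}  {false} = mk⇔ (λ ()) (λ ())
T-not-xor {true}  {true}  = mk⇔ (λ _ → refl) (λ _ → _)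

∈⇔T-lookup : x ∈ C ⇔ T (lookup C x)
∈⇔T-lookup = mk⇔ (from T-≡ ∘ []=⇒lookup) (lookup⇒[]= _ _ ∘ to T-≡)

∣p∪q∣≤∣p∣+∣q∣ : ∀ (p q : Subset n) → ∣ p ∪ q ∣ ≤ ∣ p ∣ + ∣ q ∣
∣p∪q∣≤∣p∣+∣q∣ []            []            = z≤n
∣p∪q∣≤∣p∣+∣q∣ (outside ∷ p) (outside ∷ q) = ∣p∪q∣≤∣p∣+∣q∣ p q
∣p∪q∣≤∣p∣+∣q∣ (outside ∷ p) (inside  ∷ q) =
  ≤-trans (s≤s (∣p∪q∣≤∣p∣+∣q∣ p q)) (≤-reflexive (sym (+-suc ∣ p ∣ ∣ q ∣)))
∣p∪q∣≤∣p∣+∣q∣ (inside  ∷ p) (outside ∷ q) = s≤s (∣p∪q∣≤∣p∣+∣q∣ p q)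
∣p∪q∣≤∣p∣+∣q∣ (inside  ∷ p) (inside  ∷ q) =
  s≤s (≤-trans (∣p∪q∣≤∣p∣+∣q∣ p q) (+-monoʳ-≤ ∣ p ∣ (n≤1+n ∣ q ∣)))

p⊆q∧∣q∣≤∣p∣⇒p≡q : ∀ {p q : Subset n} → p ⊆ q → ∣ q ∣ ≤ ∣ p ∣ → p ≡ q
p⊆q∧∣q∣≤∣p∣⇒p≡q {p = []}          {[]}          _   _   = refl
p⊆q∧∣q∣≤∣p∣⇒p≡q {p = outside ∷ p} {outside ∷ q} p⊆q q≤p =
  cong (outside ∷_) (p⊆q∧∣q∣≤∣p∣⇒p≡q (drop-∷-⊆ p⊆q) q≤p)
p⊆q∧∣q∣≤∣p∣⇒p≡q {p = outside ∷ p} {inside  ∷ q} p⊆q q≤p =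
  contradiction (≤-trans q≤p (p⊆q⇒∣p∣≤∣q∣ (drop-∷-⊆ p⊆q))) 1+n≰n
p⊆q∧∣q∣≤∣p∣⇒p≡q {p = inside  ∷ p} {outside ∷ q} p⊆q _   with p⊆q Vec.here
... | ()
p⊆q∧∣q∣≤∣p∣⇒p≡q {p = inside  ∷ p} {inside  ∷ q} p⊆q q≤p =
  cong (inside ∷_) (p⊆q∧∣q∣≤∣p∣⇒p≡q (drop-∷-⊆ p⊆q) (s≤s⁻¹ q≤p))

module _ {p q} {P : Pred A p} {Q : Pred A q}
         (P? : Decidable P) (Q? : Decidable Q) (P⇒Q : ∀ {x} → P x → Q x) where

  length-filter-mono : ∀ xs → length (filter P? xs) ≤ length (filter Q? xs)
  length-filter-mono xs = length-mono-≤ (filter⁺ P? Q? (λ { refl → P⇒Q }) (⊆-refl {x = xs}))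

  length-filter-< : ∀ {x xs} → x ∈ₗ xs → ¬ P x → Q x →
                    length (filter P? xs) < length (filter Q? xs)
  length-filter-< {xs = y ∷ ys} (here refl) ¬py qy with P? y | Q? y
  ... | yes py | _      = contradiction py ¬py
  ... | no _   | yes _  = s≤s (length-filter-mono ys)
  ... | no _   | no ¬qy = contradiction qy ¬qy
  length-filter-< {xs = y ∷ ys} (there x∈ys) ¬px qx with P? y | Q? y
  ... | yes _  | yes _  = s≤s (length-filter-< x∈ys ¬px qx)
  ... | yes py | no ¬qy = contradiction (P⇒Q py) ¬qy
  ... | no _   | yes _  = m≤n⇒m≤1+n (length-filter-< x∈ys ¬px qx)
  ... | no _   | no _   = length-filter-< x∈ys ¬px qx

foldr-⊓-≤ : ∀ {m} s xs → s ≡ m ⊎ m ∈ₗ xs → foldr _⊓_ s xs ≤ m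
foldr-⊓-≤ {m} s xs m∈ = foldr-preservesᵒ {P = _≤ m}
  (λ u v → [ ≤-trans (m⊓n≤m u v) , ≤-trans (m⊓n≤n u v) ]′) s xs
  (⊎-map ≤-reflexive (λ m∈xs → lose m∈xs ≤-refl) m∈)

≤-foldr-⊔ : ∀ {m} s xs → m ∈ₗ xs → m ≤ foldr _⊔_ s xs
≤-foldr-⊔ {m} s xs m∈xs = foldr-preservesᵒ {P = m ≤_}
  (λ u v → [ (λ m≤u → ≤-trans m≤u (m≤m⊔n u v)) , (λ m≤v → ≤-trans m≤v (m≤n⊔m u v)) ]′) s xs
  (inj₂ (lose m∈xs ≤-refl))

∃-argmax : ∀ (f : A → ℕ) {x xs} → x ∈ₗ xs → ∃[ y ] y ∈ₗ xs × All (λ z → f z ≤ f y) xs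
∃-argmax f {x} {xs} x∈xs =
  argmax f x xs ,
  [ (λ y≡x → subst (_∈ₗ xs) (sym y≡x) x∈xs) , (λ y∈xs → y∈xs) ]′ (argmax-sel f x xs) ,
  f[xs]≤f[argmax] {f = f} x xs

minOf : (A → ℕ) → List A → ℕ
minOf f []       = 0
minOf f (x ∷ xs) = foldr _⊓_ (f x) (map f xs)

module _ (f : A → ℕ) where

  minOf-≤ : ∀ {x xs} → x ∈ₗ xs → minOf f xs ≤ f x
  minOf-≤ {xs = _ ∷ ys} (here refl)  = foldr-⊓-≤ _ (map f ys) (inj₁ refl)
  minOf-≤ {xs = y ∷ ys} (there x∈ys) = foldr-⊓-≤ (f y) (map f ys) (inj₂ (∈-map⁺ f x∈ys))

  minOf-attained : ∀ {x xs} → x ∈ₗ xs → ∃[ y ] y ∈ₗ xs × f y ≡ minOf f xs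
  minOf-attained {xs = y ∷ ys} _ with foldr-selective ⊓-sel (f y) (map f ys)
  ... | inj₁ min≡fy = y , here refl , sym min≡fy
  ... | inj₂ min∈   = let z , z∈ys , min≡fz = ∈-map⁻ f min∈ in z , there z∈ys , sym min≡fz

isTrue? : ∀ (p : A → Bool) → Decidable (λ u → p u ≡ true)
isTrue? p u = p u ≟ᵇ true

length-filter-tabulate : ∀ (p : A → Bool) (g : Fin n → A) →
                         length (filter (isTrue? p) (List.tabulate g)) ≡ ∣ tabulate (p ∘ g) ∣
length-filter-tabulate {n = zero}  p g = refl
length-filter-tabulate {n = suc n} p g with p (g Fin.zero)
... | true  = cong suc (length-filter-tabulate p (g ∘ Fin.suc))
... | false = length-filter-tabulate p (g ∘ Fin.suc)

-- Concept classes and teaching sets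

_⊆ᶜ_ : Class n → Class n → Set
𝒞 ⊆ᶜ 𝒟 = ∀ C → T (𝒞 C) → T (𝒟 C)

∈-allSubsets : ∀ (C : Subset n) → C ∈ₗ allSubsets n
∈-allSubsets []          = here refl
∈-allSubsets (true ∷ C)  = ∈-++⁺ˡ (∈-map⁺ (true ∷_) (∈-allSubsets C))
∈-allSubsets (false ∷ C) = ∈-++⁺ʳ _ (∈-map⁺ (false ∷_) (∈-allSubsets C))

length-allSubsets : ∀ n → length (allSubsets n) ≡ 2 ^ n
length-allSubsets zero    = refl
length-allSubsets (suc n) = begin
  length (map (true ∷_) Cs ++ map (false ∷_) Cs)         ≡⟨ length-++ (map (true ∷_) Cs) ⟩
  length (map (true ∷_) Cs) + length (map (false ∷_) Cs) ≡⟨ cong₂ _+_ (length-map _ Cs)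
                                                                      (length-map _ Cs) ⟩
  length Cs + length Cs                                  ≡⟨ cong (λ k → k + k)
                                                                 (length-allSubsets n) ⟩
  2 ^ n + 2 ^ n                                          ≡⟨ cong (2 ^ n +_)
                                                                 (sym (+-identityʳ (2 ^ n))) ⟩
  2 ^ suc n                                              ∎
  where
  Cs = allSubsets n
  open ≡-Reasoning

∈-members : ∀ (𝒞 : Class n) → C ∈ₗ members 𝒞 ⇔ T (𝒞 C)
∈-members 𝒞 = mk⇔ (from T-≡ ∘ proj₂ ∘ ∈-filter⁻ (isTrue? 𝒞) {xs = allSubsets _})
                  (∈-filter⁺ (isTrue? 𝒞) (∈-allSubsets _) ∘ to T-≡)

length-members≤2^n : ∀ (𝒞 : Class n) → length (members 𝒞) ≤ 2 ^ n
length-members≤2^n {n} 𝒞 =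
  ≤-trans (length-filter (isTrue? 𝒞) (allSubsets n)) (≤-reflexive (length-allSubsets n))

length-members< : ∀ (𝒟 𝒞 : Class n) → 𝒟 ⊆ᶜ 𝒞 → T (𝒞 C) → ¬ T (𝒟 C) →
                  length (members 𝒟) < length (members 𝒞)
length-members< {C = C} 𝒟 𝒞 𝒟⊆𝒞 C∈𝒞 C∉𝒟 =
  length-filter-< (isTrue? 𝒟) (isTrue? 𝒞) (to T-≡ ∘ 𝒟⊆𝒞 _ ∘ from T-≡)
                  (∈-allSubsets C) (C∉𝒟 ∘ from T-≡) (to T-≡ C∈𝒞)

Distinguishes : Subset n → Concept n → Concept n → Set
Distinguishes D C C′ = ∃[ z ] z ∈ D × lookup C z ≢ lookup C′ z

distinguishesAt : Subset n → Concept n → Concept n → Fin n → Bool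
distinguishesAt D C C′ z = lookup D z ∧ (lookup C z xor lookup C′ z)

distinguishes : Subset n → Concept n → Concept n → Bool
distinguishes {n} D C C′ = any (distinguishesAt D C C′) (allFin n)

T-distinguishes : ∀ (D C C′ : Subset n) → T (distinguishes D C C′) ⇔ Distinguishes D C C′
T-distinguishes {n} D C C′ = mk⇔
  (λ t → let z , z∈D∧differ = satisfied (any⁻ (distinguishesAt D C C′) (allFin n) t)
             z∈D , differ   = to (T-∧ {lookup D z}) z∈D∧differ
         in z , from ∈⇔T-lookup z∈D , to T-xor differ)
  (λ (z , z∈D , differ) → any⁺ (distinguishesAt D C C′)
     (lose (∈-allFin z) (from T-∧ (to ∈⇔T-lookup z∈D , from T-xor differ))))

T-eqC : T (eqC C C′) ⇔ C ≡ C′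
T-eqC {n} {C} {C′} = mk⇔
  (λ t → begin
    C                    ≡⟨ sym (tabulate∘lookup C) ⟩
    tabulate (lookup C)  ≡⟨ tabulate-cong (λ z → to T-not-xor
                              (All.lookup (all⁺ agree (allFin n) t) (∈-allFin z))) ⟩
    tabulate (lookup C′) ≡⟨ tabulate∘lookup C′ ⟩
    C′                   ∎)
  (λ { refl → all⁻ agree {xs = allFin n}
                (All.tabulate (λ {z} _ → from (T-not-xor {lookup C z}) refl)) })
  where
  open ≡-Reasoning
  agree : Fin n → Bool
  agree z = not (lookup C z xor lookup C′ z)

differ-only-at⇒∈ : (∀ {z} → z ≢ y → lookup C z ≡ lookup C′ z) → Distinguishes D C C′ → y ∈ D
differ-only-at⇒∈ {y = y} agree (z , z∈D , differ) with z ≟ y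
... | yes refl = z∈D
... | no z≢y   = contradiction (agree z≢y) differ

IsTeachingSet : Class n → Concept n → Subset n → Set
IsTeachingSet 𝒞 C D = ∀ C′ → T (𝒞 C′) → C′ ≢ C → Distinguishes D C C′

T-isTeachingSet : ∀ (𝒞 : Class n) C D → T (isTeachingSet 𝒞 C D) ⇔ IsTeachingSet 𝒞 C D
T-isTeachingSet 𝒞 C D = mk⇔ sound complete
  where
  equal-or-distinguished : Concept _ → Bool
  equal-or-distinguished C′ = eqC C′ C ∨ distinguishes D C C′

  sound : T (isTeachingSet 𝒞 C D) → IsTeachingSet 𝒞 C D
  sound ts C′ C′∈𝒞 C′≢C =
    [ (λ same → contradiction (to T-eqC same) C′≢C) , to (T-distinguishes D C C′) ]′
      (to (T-∨ {eqC C′ C})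
          (All.lookup (all⁺ equal-or-distinguished (members 𝒞) ts) (from (∈-members 𝒞) C′∈𝒞)))

  complete : IsTeachingSet 𝒞 C D → T (isTeachingSet 𝒞 C D)
  complete teaches = all⁻ equal-or-distinguished
    (All.tabulate (λ {C′} C′∈ → from T-∨ (decide C′ (to (∈-members 𝒞) C′∈))))
    where
    decide : ∀ C′ → T (𝒞 C′) → T (eqC C′ C) ⊎ T (distinguishes D C C′)
    decide C′ C′∈𝒞 with ≡-dec _≟ᵇ_ C′ C
    ... | yes C′≡C = inj₁ (from T-eqC C′≡C)
    ... | no C′≢C  = inj₂ (from (T-distinguishes D C C′) (teaches C′ C′∈𝒞 C′≢C))

largest-teaches-itself : ∀ (𝒞 : Class n) C → (∀ C′ → T (𝒞 C′) → ∣ C′ ∣ ≤ ∣ C ∣) →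
                         T (isTeachingSet 𝒞 C C)
largest-teaches-itself 𝒞 C largest = from (T-isTeachingSet 𝒞 C C) distinguished
  where
  distinguished : IsTeachingSet 𝒞 C C
  distinguished C′ C′∈𝒞 C′≢C with T? (distinguishes C C C′)
  ... | yes d = to (T-distinguishes C C C′) d
  ... | no ¬d = contradiction (sym (p⊆q∧∣q∣≤∣p∣⇒p≡q C⊆C′ (largest C′ C′∈𝒞))) C′≢C
    where
    C⊆C′ : C ⊆ C′
    C⊆C′ {z} z∈C with z ∈? C′
    ... | yes z∈C′ = z∈C′
    ... | no z∉C′  = contradiction (from (T-distinguishes C C C′) (z , z∈C , z∉C′ ∘ moved)) ¬d
      where
      moved : lookup C z ≡ lookup C′ z → z ∈ C′
      moved same = lookup⇒[]= z C′ (trans (sym same) ([]=⇒lookup z∈C))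

TD≤∣D∣ : ∀ (𝒞 : Class n) C D → T (isTeachingSet 𝒞 C D) → TD 𝒞 C ≤ ∣ D ∣
TD≤∣D∣ 𝒞 C D ts = foldr-⊓-≤ _ (map ∣_∣ (filter teaches? (allSubsets _)))
  (inj₂ (∈-map⁺ ∣_∣ (∈-filter⁺ teaches? (∈-allSubsets D) (to T-≡ ts))))
  where teaches? = isTrue? (isTeachingSet 𝒞 C)

≤TD : ∀ {n} (𝒞 : Class n) C → b ≤ n → (∀ D → T (isTeachingSet 𝒞 C D) → b ≤ ∣ D ∣) → b ≤ TD 𝒞 C
≤TD {b = b} {n} 𝒞 C b≤n lower = foldr-preservesᵇ {P = b ≤_} ⊓-glb b≤n (map⁺ (All.tabulate
  (λ {D} D∈ → lower D (from T-≡ (proj₂ (∈-filter⁻ teaches? {xs = allSubsets n} D∈))))))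
  where teaches? = isTrue? (isTeachingSet 𝒞 C)

-- Recursive teaching dimension

-- `with members 𝒞` normalises the goal, so it would also abstract the members 𝒞 hidden
-- inside TD 𝒞; an opaque copy of TD is immune to that.
opaque
  TD⁼ : Class n → Concept n → ℕ
  TD⁼ = TD

  TD⁼≡TD : TD⁼ {n} ≡ TD
  TD⁼≡TD = refl

TDmin≡minOf : ∀ (𝒞 : Class n) → TDmin 𝒞 ≡ minOf (TD 𝒞) (members 𝒞)
TDmin≡minOf 𝒞 = trans (unfold-with-TD⁼ 𝒞) (cong (λ td → minOf (td 𝒞) (members 𝒞)) TD⁼≡TD)
  where
  unfold-with-TD⁼ : ∀ 𝒞 → TDmin 𝒞 ≡ minOf (TD⁼ 𝒞) (members 𝒞)
  unfold-with-TD⁼ 𝒞 with members 𝒞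
  ... | []     = refl
  ... | C ∷ Cs = cong (λ td → minOf (td 𝒞) (C ∷ Cs)) (sym TD⁼≡TD)

TDmin≤TD : ∀ (𝒞 : Class n) → T (𝒞 C) → TDmin 𝒞 ≤ TD 𝒞 C
TDmin≤TD {C = C} 𝒞 C∈𝒞 =
  subst (_≤ TD 𝒞 C) (sym (TDmin≡minOf 𝒞)) (minOf-≤ (TD 𝒞) (from (∈-members 𝒞) C∈𝒞))

T-Cmin : ∀ (𝒞 : Class n) → T (Cmin 𝒞 C) ⇔ (T (𝒞 C) × TD 𝒞 C ≡ TDmin 𝒞)
T-Cmin {C = C} 𝒞 = mk⇔
  (λ t → let C∈𝒞 , minimal = to (T-∧ {𝒞 C}) t in C∈𝒞 , toWitness minimal)
  (λ (C∈𝒞 , TD≡TDmin) → from T-∧ (C∈𝒞 , fromWitness TD≡TDmin))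

T-Crest : ∀ (𝒞 : Class n) → T (Crest 𝒞 C) ⇔ (T (𝒞 C) × ¬ T (Cmin 𝒞 C))
T-Crest {C = C} 𝒞 = mk⇔
  (λ t → let C∈𝒞 , not-min = to (T-∧ {𝒞 C}) t in C∈𝒞 , to T-not not-min)
  (λ (C∈𝒞 , not-min) → from T-∧ (C∈𝒞 , from T-not not-min))

Crest⊆ : ∀ (𝒞 : Class n) → Crest 𝒞 ⊆ᶜ 𝒞
Crest⊆ 𝒞 _ = proj₁ ∘ to (T-Crest 𝒞)

¬allMin : ∀ (𝒞 : Class n) → T (𝒞 C) → ¬ T (Cmin 𝒞 C) → ¬ T (allMin 𝒞)
¬allMin 𝒞 C∈𝒞 not-min all-min =
  not-min (All.lookup (all⁺ (Cmin 𝒞) (members 𝒞) all-min) (from (∈-members 𝒞) C∈𝒞))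

Cmin-nonempty : ∀ (𝒞 : Class n) → T (𝒞 C) → ∃[ C′ ] T (Cmin 𝒞 C′)
Cmin-nonempty 𝒞 C∈𝒞 =
  let C′ , C′∈ , TD≡min = minOf-attained (TD 𝒞) (from (∈-members 𝒞) C∈𝒞) in
  C′ , from (T-Cmin 𝒞) (to (∈-members 𝒞) C′∈ , trans TD≡min (sym (TDmin≡minOf 𝒞)))

length-members-Crest< : ∀ (𝒞 : Class n) → T (𝒞 C) →
                        length (members (Crest 𝒞)) < length (members 𝒞)
length-members-Crest< 𝒞 C∈𝒞 =
  let C′ , C′-min = Cmin-nonempty 𝒞 C∈𝒞 in
  length-members< (Crest 𝒞) 𝒞 (Crest⊆ 𝒞) (proj₁ (to (T-Cmin 𝒞) C′-min))
    (λ C′∈rest → proj₂ (to (T-Crest 𝒞) C′∈rest) C′-min)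

TDmin≤RTD-fuel : ∀ k (𝒞 : Class n) → TDmin 𝒞 ≤ RTD-fuel (suc k) 𝒞
TDmin≤RTD-fuel k 𝒞 with allMin 𝒞
... | true  = ≤-refl
... | false = m≤m⊔n _ _

RTD-fuel-Crest≤ : ∀ k (𝒞 : Class n) → ¬ T (allMin 𝒞) → RTD-fuel k (Crest 𝒞) ≤ RTD-fuel (suc k) 𝒞
RTD-fuel-Crest≤ k 𝒞 not-all with allMin 𝒞
... | true  = contradiction _ not-all
... | false = m≤n⊔m (TDmin 𝒞) _

TDmin≤maxSize : ∀ (𝒞 : Class n) → (∀ C → T (𝒞 C) → ∣ C ∣ ≤ b) → TDmin 𝒞 ≤ b
TDmin≤maxSize {b = b} 𝒞 bounded = go (members 𝒞) refl
  where
  open ≤-Reasoning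
  go : ∀ Cs → Cs ≡ members 𝒞 → TDmin 𝒞 ≤ b
  go []       empty = begin
    TDmin 𝒞                  ≡⟨ TDmin≡minOf 𝒞 ⟩
    minOf (TD 𝒞) (members 𝒞) ≡⟨ cong (minOf (TD 𝒞)) (sym empty) ⟩
    0                        ≤⟨ z≤n ⟩
    b                        ∎
  go (C₀ ∷ _) eq    =
    let C , C∈ , largest = ∃-argmax ∣_∣ (subst (C₀ ∈ₗ_) eq (here refl)) in begin
    TDmin 𝒞  ≤⟨ TDmin≤TD 𝒞 (to (∈-members 𝒞) C∈) ⟩
    TD 𝒞 C   ≤⟨ TD≤∣D∣ 𝒞 C C (largest-teaches-itself 𝒞 C
                  (λ _ → All.lookup largest ∘ from (∈-members 𝒞))) ⟩
    ∣ C ∣    ≤⟨ bounded C (to (∈-members 𝒞) C∈) ⟩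
    b        ∎

RTD-fuel≤maxSize : ∀ k (𝒞 : Class n) → (∀ C → T (𝒞 C) → ∣ C ∣ ≤ b) → RTD-fuel k 𝒞 ≤ b
RTD-fuel≤maxSize zero    𝒞 bounded = z≤n
RTD-fuel≤maxSize (suc k) 𝒞 bounded with allMin 𝒞
... | true  = TDmin≤maxSize 𝒞 bounded
... | false = ⊔-lub (TDmin≤maxSize 𝒞 bounded)
                    (RTD-fuel≤maxSize k (Crest 𝒞) (λ C → bounded C ∘ Crest⊆ 𝒞 C))

RTD≤maxSize : ∀ (𝒞 : Class n) → (∀ C → T (𝒞 C) → ∣ C ∣ ≤ b) → RTD 𝒞 ≤ b
RTD≤maxSize {n = n} = RTD-fuel≤maxSize (2 ^ n + 1)

module _ {S : Class n}
         (hard : ∀ {𝒟} → S ⊆ᶜ 𝒟 → ∀ c → T (S c) → b ≤ TD 𝒟 c)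
         (c₀ : Concept n) (c₀∈S : T (S c₀)) where

  ≤RTD-fuel : ∀ k (𝒞 : Class n) → S ⊆ᶜ 𝒞 → length (members 𝒞) < k → b ≤ RTD-fuel k 𝒞
  ≤RTD-fuel (suc k) 𝒞 S⊆𝒞 enough-fuel with any? (λ c → T? (S c ∧ Cmin 𝒞 c)) (allSubsets n)
  ... | yes some-minimal =
    let c , c∈S∧min = satisfied some-minimal
        c∈S , c-min = to (T-∧ {S c}) c∈S∧min
    in begin
    b                    ≤⟨ hard S⊆𝒞 c c∈S ⟩
    TD 𝒞 c               ≡⟨ proj₂ (to (T-Cmin 𝒞) c-min) ⟩
    TDmin 𝒞              ≤⟨ TDmin≤RTD-fuel k 𝒞 ⟩
    RTD-fuel (suc k) 𝒞   ∎
    where open ≤-Reasoning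
  ... | no none-minimal = ≤-trans (≤RTD-fuel k (Crest 𝒞) S⊆rest enough-fuel′)
                                  (RTD-fuel-Crest≤ k 𝒞 (¬allMin 𝒞 (S⊆𝒞 c₀ c₀∈S) (not-min c₀∈S)))
    where
    not-min : ∀ {c} → T (S c) → ¬ T (Cmin 𝒞 c)
    not-min {c} c∈S c-min = none-minimal (lose (∈-allSubsets c) (from T-∧ (c∈S , c-min)))

    S⊆rest : S ⊆ᶜ Crest 𝒞
    S⊆rest c c∈S = from (T-Crest 𝒞) (S⊆𝒞 c c∈S , not-min c∈S)

    enough-fuel′ : length (members (Crest 𝒞)) < k
    enough-fuel′ = ≤-trans (length-members-Crest< 𝒞 (S⊆𝒞 c₀ c₀∈S)) (s≤s⁻¹ enough-fuel)

  ≤RTD : ∀ (𝒞 : Class n) → S ⊆ᶜ 𝒞 → b ≤ RTD 𝒞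
  ≤RTD 𝒞 S⊆𝒞 =
    ≤RTD-fuel (2 ^ n + 1) 𝒞 S⊆𝒞 (≤-<-trans (length-members≤2^n 𝒞) (m<m+n (2 ^ n) z<s))

-- Stars of a graph

module _ (G : Graph n) where

  nbhd : Fin n → Subset n
  nbhd x = tabulate (adj G x)

  ∈-nbhd : y ∈ nbhd x ⇔ T (adj G x y)
  ∈-nbhd {y = y} {x} = mk⇔ (subst T (lookup∘tabulate (adj G x) y) ∘ to ∈⇔T-lookup)
                           (from ∈⇔T-lookup ∘ subst T (sym (lookup∘tabulate (adj G x) y)))

  adj⇒≢ : T (adj G x y) → x ≢ y
  adj⇒≢ {x = x} x~y refl = subst T (irrfl G x) x~y

  degree≡∣nbhd∣ : ∀ x → degree G x ≡ ∣ nbhd x ∣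
  degree≡∣nbhd∣ x = length-filter-tabulate (adj G x) (λ y → y)

  degree≤n : ∀ x → degree G x ≤ n
  degree≤n x = subst (_≤ n) (sym (degree≡∣nbhd∣ x)) (∣p∣≤n (nbhd x))

  degree≤Δ : ∀ x → degree G x ≤ Δ G
  degree≤Δ x = ≤-foldr-⊔ 0 _ (∈-map⁺ (degree G) (∈-allFin x))

  Δ-attained : Δ G ≡ 0 ⊎ ∃[ x ] degree G x ≡ Δ G
  Δ-attained with foldr-selective ⊔-sel 0 (map (degree G) (allFin n))
  ... | inj₁ Δ≡0 = inj₁ Δ≡0
  ... | inj₂ Δ∈  = let x , _ , Δ≡degree = ∈-map⁻ (degree G) Δ∈ in inj₂ (x , sym Δ≡degree)

  insideStar : Fin n → Concept n → Fin n → Bool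
  insideStar x C y = not (lookup C y) ∨ ⌊ y ≟ x ⌋ ∨ adj G x y

  starAt : Fin n → Class n
  starAt x C = lookup C x ∧ all (insideStar x C) (allFin n)

  ∈⁅x⁆∪nbhd : y ∈ ⁅ x ⁆ ∪ nbhd x ⇔ T (⌊ y ≟ x ⌋ ∨ adj G x y)
  ∈⁅x⁆∪nbhd {y = y} {x} = mk⇔
    (λ y∈ → from T-∨ (⊎-map (fromWitness ∘ to x∈⁅y⁆⇔x≡y) (to ∈-nbhd)
                             (x∈p∪q⁻ ⁅ x ⁆ (nbhd x) y∈)))
    (λ t → x∈p∪q⁺ (⊎-map (from x∈⁅y⁆⇔x≡y ∘ toWitness) (from ∈-nbhd)
                         (to (T-∨ {⌊ y ≟ x ⌋}) t)))

  T-starAt : ∀ x C → T (starAt x C) ⇔ (x ∈ C × C ⊆ ⁅ x ⁆ ∪ nbhd x)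
  T-starAt x C = mk⇔
    (λ t → let x∈C , spokes = to (T-∧ {lookup C x}) t in
      from ∈⇔T-lookup x∈C ,
      λ {y} y∈C → from ∈⁅x⁆∪nbhd
        (to T-not-∨ (All.lookup (all⁺ (insideStar x C) (allFin n) spokes) (∈-allFin y))
                    (to ∈⇔T-lookup y∈C)))
    (λ (x∈C , C⊆) → from T-∧ (to ∈⇔T-lookup x∈C ,
      all⁻ (insideStar x C) {xs = allFin n} (All.tabulate (λ {y} _ →
        from (T-not-∨ {lookup C y}) (λ y∈C → to ∈⁅x⁆∪nbhd (C⊆ (from ∈⇔T-lookup y∈C)))))))

  starAt⊆Cstar : ∀ x → starAt x ⊆ᶜ Cstar G
  starAt⊆Cstar x C star = any⁺ (λ x → starAt x C) (lose (∈-allFin x) star)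

  ∣Cstar∣≤Δ+1 : ∀ C → T (Cstar G C) → ∣ C ∣ ≤ Δ G + 1
  ∣Cstar∣≤Δ+1 C t =
    let x , star = satisfied (any⁻ (λ x → starAt x C) (allFin n) t) in begin
    ∣ C ∣                  ≤⟨ p⊆q⇒∣p∣≤∣q∣ (proj₂ (to (T-starAt x C) star)) ⟩
    ∣ ⁅ x ⁆ ∪ nbhd x ∣     ≤⟨ ∣p∪q∣≤∣p∣+∣q∣ ⁅ x ⁆ (nbhd x) ⟩
    ∣ ⁅ x ⁆ ∣ + ∣ nbhd x ∣ ≡⟨ cong₂ _+_ (∣⁅x⁆∣≡1 x) (sym (degree≡∣nbhd∣ x)) ⟩
    1 + degree G x         ≤⟨ s≤s (degree≤Δ x) ⟩
    1 + Δ G                ≡⟨ +-comm 1 (Δ G) ⟩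
    Δ G + 1                ∎
    where open ≤-Reasoning

  ⁅x⁆-star : ∀ x → T (starAt x ⁅ x ⁆)
  ⁅x⁆-star x = from (T-starAt x ⁅ x ⁆) (x∈⁅x⁆ x , x∈p∪q⁺ ∘ inj₁)

  toggle-star : ∀ {bit} → y ∈ nbhd x → T (starAt x c) → T (starAt x (c [ y ]≔ bit))
  toggle-star {y = y} {x} {c} {bit} y∈N star =
    from (T-starAt x (c [ y ]≔ bit)) ([]≔-minimal c x y (adj⇒≢ (to ∈-nbhd y∈N)) x∈c , c′⊆)
    where
    x∈c = proj₁ (to (T-starAt x c) star)
    c⊆  = proj₂ (to (T-starAt x c) star)
    c′⊆ : c [ y ]≔ bit ⊆ ⁅ x ⁆ ∪ nbhd x
    c′⊆ {z} z∈c′ with z ≟ y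
    ... | yes refl = x∈p∪q⁺ (inj₂ y∈N)
    ... | no z≢y   =
      c⊆ (lookup⇒[]= z c (trans (sym (lookup∘update′ z≢y c bit)) ([]=⇒lookup z∈c′)))

  nbhd⊆teachingSet : starAt x ⊆ᶜ 𝒟 → ∀ c → T (starAt x c) →
                     ∀ D → T (isTeachingSet 𝒟 c D) → nbhd x ⊆ D
  nbhd⊆teachingSet {x = x} {𝒟} stars⊆𝒟 c star D ts {y} y∈N =
    differ-only-at⇒∈ {C = c} {C′ = c′} (λ z≢y → sym (lookup∘update′ z≢y c _))
      (to (T-isTeachingSet 𝒟 c D) ts c′ (stars⊆𝒟 c′ (toggle-star {c = c} y∈N star)) c′≢c)
    where
    c′ = c [ y ]≔ not (lookup c y)
    c′≢c : c′ ≢ c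
    c′≢c same = not-¬ refl (trans (sym (cong (λ v → lookup v y) same)) (lookup∘update y c _))

  degree≤TD : ∀ x → starAt x ⊆ᶜ 𝒟 → ∀ c → T (starAt x c) → degree G x ≤ TD 𝒟 c
  degree≤TD {𝒟 = 𝒟} x stars⊆𝒟 c star = ≤TD 𝒟 c (degree≤n x) λ D ts →
    subst (_≤ ∣ D ∣) (sym (degree≡∣nbhd∣ x))
          (p⊆q⇒∣p∣≤∣q∣ (nbhd⊆teachingSet stars⊆𝒟 c star D ts))

  Δ≤RTD-Cstar : Δ G ≤ RTD (Cstar G)
  Δ≤RTD-Cstar with Δ-attained
  ... | inj₁ Δ≡0         = subst (_≤ RTD (Cstar G)) (sym Δ≡0) z≤n
  ... | inj₂ (x , deg≡Δ) = subst (_≤ RTD (Cstar G)) deg≡Δ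
    (≤RTD (degree≤TD x) ⁅ x ⁆ (⁅x⁆-star x) (Cstar G) (starAt⊆Cstar x))

theorem2 : ∀ {n : ℕ} (G : Graph n) → (Δ G ≤ RTD (Cstar G)) × (RTD (Cstar G) ≤ Δ G + 1)
theorem2 G = Δ≤RTD-Cstar G , RTD≤maxSize (Cstar G) (∣Cstar∣≤Δ+1 G)
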